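{- Let $\sigma$ be a permutation of $[n]$ and $i\in[n]$. Then $(31\text{ - }2)(i)+(2\text{ - }31)(i)=h_i$ if $i$ is the beginning of an ascent, and $(31\text{ - }2)(i)+(2\text{ - }31)(i)=h_i-1$ if $i$ is the beginning of a descent.
   Context: Given a permutation $\sigma$ of $[n]$, set $\sigma(0)=0$ and $\sigma(n+1)=n+1$. For a value $i\in[n]$ with $\sigma(j)=i$: $i$ is a valley if $\sigma(j-1)>\sigma(j)<\sigma(j+1)$, a double ascent if $\sigma(j-1)<\sigma(j)<\sigma(j+1)$, a double descent if $\sigma(j-1)>\sigma(j)>\sigma(j+1)$, a peak if $\sigma(j-1)<\sigma(j)>\sigma(j+1)$; $i$ is the beginning of a descent if $\sigma(j)>\sigma(j+1)$ and the beginning of an ascent if $\sigma(j)<\sigma(j+1)$. Define $(31\text{ - }2)(i)$ (resp. $(2\text{ - }31)(i)$) as the number of indices $k<j$ (resp. $k>j$), $1\le k\le n+1$, with $\sigma(k-1)>\sigma(j)>\sigma(k)$. Define the word $c=(c_1,\dots,c_n)$ by $c_i=N$ if $i$ is a valley, $c_i=E$ if $i$ is a double ascent, $c_i=\bar E$ if $i$ is a double descent, $c_i=S$ if $i$ is a peak, and set $h_i=|\{t<i : c_t=N\}|-|\{t<i : c_t=S\}|$. -}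

module Defs where

open import Data.Nat using (ℕ; zero; suc; _<_; _>_; _∸_; _+_; _<?_)
open import Data.Nat.Properties using (<-cmp)
open import Data.Fin using (Fin; toℕ; fromℕ<)
open import Data.Fin.Permutation using (Permutation′; _⟨$⟩ʳ_; _⟨$⟩ˡ_)
open import Data.List using (List; length; filter; map; upTo)
open import Data.List.Base using (allFin)
open import Data.Product using (_×_)
open import Relation.Nullary using (yes; no)
open import Relation.Nullary.Decidable using (_×-dec_)
open import Relation.Unary using (Decidable)
open import Data.Integer using (ℤ; +_; _-_)

-- A permutation σ of [n] is a Permutation′ n on Fin n; the value v : Fin n
-- stands for the integer toℕ v + 1 ∈ [n] (so [n] = {1..n}).

-- The extended word: positions 0..n+1, with σ(0) = 0 and σ(n+1) = n+1.
-- Position k (1 ≤ k ≤ n) holds  toℕ (σ ⟨$⟩ʳ (k-1)) + 1.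
ext : ∀ {n} → Permutation′ n → ℕ → ℕ
ext σ zero = 0
ext {n} σ (suc k) with k <? n
... | yes k<n = suc (toℕ (σ ⟨$⟩ʳ fromℕ< k<n))
... | no _ = suc n

val : ∀ {n} → Fin n → ℕ
val v = suc (toℕ v)

pos : ∀ {n} → Permutation′ n → Fin n → ℕ
pos σ v = suc (toℕ (σ ⟨$⟩ˡ v))

before after : ∀ {n} → Permutation′ n → Fin n → ℕ
before σ v = ext σ (Data.Nat.pred (pos σ v))
after σ v = ext σ (suc (pos σ v))

Valley : ∀ {n} → Permutation′ n → Fin n → Set
Valley σ v = before σ v > val v × val v < after σ v

Peak : ∀ {n} → Permutation′ n → Fin n → Set
Peak σ v = before σ v < val v × val v > after σ v

DoubleAscent : ∀ {n} → Permutation′ n → Fin n → Set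
DoubleAscent σ v = before σ v < val v × val v < after σ v

DoubleDescent : ∀ {n} → Permutation′ n → Fin n → Set
DoubleDescent σ v = before σ v > val v × val v > after σ v

AscentStart : ∀ {n} → Permutation′ n → Fin n → Set
AscentStart σ v = val v < after σ v

DescentStart : ∀ {n} → Permutation′ n → Fin n → Set
DescentStart σ v = val v > after σ v

valley? : ∀ {n} (σ : Permutation′ n) → Decidable (Valley σ)
valley? σ v = (val v <? before σ v) ×-dec (val v <? after σ v)

peak? : ∀ {n} (σ : Permutation′ n) → Decidable (Peak σ)
peak? σ v = (before σ v <? val v) ×-dec (after σ v <? val v)

-- h_i = #{t < i : c_t = N} - #{t < i : c_t = S}
h : ∀ {n} → Permutation′ n → Fin n → ℤ
h {n} σ i =
  + length (filter (λ t → (toℕ t <? toℕ i) ×-dec valley? σ t) (allFin n))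
  - + length (filter (λ t → (toℕ t <? toℕ i) ×-dec peak? σ t) (allFin n))

Straddle : ∀ {n} → Permutation′ n → Fin n → ℕ → Set
Straddle σ v k = ext σ (Data.Nat.pred k) > val v × val v > ext σ k

straddle? : ∀ {n} (σ : Permutation′ n) (v : Fin n) → Decidable (Straddle σ v)
straddle? σ v k = (val v <? ext σ (Data.Nat.pred k)) ×-dec (ext σ k <? val v)

-- (31-2)(v): indices k with 1 ≤ k < j, j = pos σ v
pat31-2 : ∀ {n} → Permutation′ n → Fin n → ℕ
pat31-2 σ v = length (filter (straddle? σ v) (map suc (upTo (toℕ (σ ⟨$⟩ˡ v)))))

-- (2-31)(v): indices k with j < k ≤ n+1
pat2-31 : ∀ {n} → Permutation′ n → Fin n → ℕ
pat2-31 {n} σ v =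
  length (filter (straddle? σ v) (map (λ m → suc (pos σ v + m)) (upTo (n ∸ toℕ (σ ⟨$⟩ˡ v)))))

-- In the extended word w = 0 σ(1) … σ(n) (n+1) call a letter below if it is smaller
-- than v = σ(j).  Around every letter t below v, with neighbours b and a,
--   [t valley] + [t > a] = [t peak] + [b > t],
-- so summed over the letters below v, valleys − peaks = (descents into them) −
-- (descents out of them).  Since 0 starts an ascent and n+1 is not below v, this
-- difference counts the descents b > a with a < v ≤ b: those with b > v are exactly
-- the straddles counted by (31-2)(v) + (2-31)(v), and the one with b = v exists iff
-- v begins a descent.
module Submission where

open import Level using (Level)
open import Data.Nat using (ℕ; zero; suc; _+_; _∸_; _<_; _≤_; _<?_; _≟_; z≤n; s≤s; s≤s⁻¹; s<s; s<s⁻¹)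
open import Data.Nat.Properties
  using ( suc-injective; 0≢1+n; 1+n≢0; 1+n≢n; n≢0⇒n>0; <-cmp; <-irrefl; <-trans; <-asym; <⇒≤
        ; ≤∧≮⇒≡; ≮⇒≥; m≤n⇒m≤1+n; m≤m+n; m+n∸m≡n; m+[n∸m]≡n
        ; +-assoc; +-comm; +-identityʳ; +-cancelʳ-≡; +-0-commutativeMonoid)
open import Data.Integer using (+_; _-_; _⊖_)
import Data.Integer.Properties as ℤ
open import Data.Fin using (Fin; toℕ; fromℕ<) renaming (zero to fzero; suc to fsuc)
open import Data.Fin.Properties using (toℕ<n; toℕ-injective; fromℕ<-toℕ; toℕ-fromℕ<)
open import Data.Fin.Permutation using (Permutation′; _⟨$⟩ʳ_; _⟨$⟩ˡ_; inverseˡ; inverseʳ)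
open import Data.List using (filter; map; applyUpTo; tabulate; length; allFin)
open import Data.Product using (_×_; _,_; proj₁; proj₂; map₁)
open import Function using (_∘_; id)
open import Relation.Nullary using (Dec; yes; no; ¬_; contradiction)
open import Relation.Nullary.Decidable using (_×-dec_)
open import Relation.Unary using (Decidable)
open import Relation.Binary using (tri<; tri≈; tri>)
open import Relation.Binary.PropositionalEquality
open import Algebra.Properties.CommutativeMonoid.Sum +-0-commutativeMonoid
  using (sum; sum-cong-≗; ∑-distrib-+; sum-replicate-zero; sum-permute)
open import Defs
open ≡-Reasoning

private variable
  a b : Level
  A B : Set a

⟦_⟧ : Dec A → ℕ
⟦ yes _ ⟧ = 1
⟦ no _ ⟧ = 0

⟦⟧-yes : (d : Dec A) → A → ⟦ d ⟧ ≡ 1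
⟦⟧-yes (yes _) _ = refl
⟦⟧-yes (no ¬p) p = contradiction p ¬p

⟦⟧-no : (d : Dec A) → ¬ A → ⟦ d ⟧ ≡ 0
⟦⟧-no (yes p) ¬p = contradiction p ¬p
⟦⟧-no (no _) _ = refl

⟦⟧-cong : (A → B) → (B → A) → (d : Dec A) (e : Dec B) → ⟦ d ⟧ ≡ ⟦ e ⟧
⟦⟧-cong f g (yes p) e = sym (⟦⟧-yes e (f p))
⟦⟧-cong f g (no ¬p) e = sym (⟦⟧-no e (¬p ∘ g))

⟦⟧-×-yesʳ : (d : Dec A) (e : Dec B) → B → ⟦ d ×-dec e ⟧ ≡ ⟦ d ⟧
⟦⟧-×-yesʳ d e q = ⟦⟧-cong proj₁ (_, q) (d ×-dec e) d

∑< : ℕ → (ℕ → ℕ) → ℕ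
∑< m f = sum {m} (f ∘ toℕ)

∑<-cong : ∀ m {f g : ℕ → ℕ} → (∀ k → k < m → f k ≡ g k) → ∑< m f ≡ ∑< m g
∑<-cong m f≡g = sum-cong-≗ (λ k → f≡g (toℕ k) (toℕ<n k))

∑<-+ : ∀ m (f g : ℕ → ℕ) → ∑< m (λ k → f k + g k) ≡ ∑< m f + ∑< m g
∑<-+ m f g = ∑-distrib-+ {m} (f ∘ toℕ) (g ∘ toℕ)

∑<-suc : ∀ m (f : ℕ → ℕ) → ∑< (suc m) f ≡ ∑< m f + f m
∑<-suc zero f = +-comm (f 0) 0
∑<-suc (suc m) f = trans (cong (_+_ (f 0)) (∑<-suc m (f ∘ suc))) (sym (+-assoc (f 0) _ _))

∑<-zero : ∀ m (f : ℕ → ℕ) → (∀ k → k < m → f k ≡ 0) → ∑< m f ≡ 0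
∑<-zero m f f≡0 = trans (∑<-cong m f≡0) (sum-replicate-zero m)

∑<-single : ∀ m {c} (f : ℕ → ℕ) → c < m → (∀ k → k < m → k ≢ c → f k ≡ 0) → ∑< m f ≡ f c
∑<-single (suc m) {zero} f _ f≡0 =
  trans (cong (_+_ (f 0)) (∑<-zero m (f ∘ suc) (λ k k<m → f≡0 (suc k) (s≤s k<m) λ ())))
        (+-identityʳ (f 0))
∑<-single (suc m) {suc c} f (s≤s c<m) f≡0 =
  trans (cong (_+ ∑< m (f ∘ suc)) (f≡0 0 (s≤s z≤n) λ ()))
        (∑<-single m (f ∘ suc) c<m λ k k<m k≢c → f≡0 (suc k) (s≤s k<m) (k≢c ∘ suc-injective))

∑<-split : ∀ m l (f : ℕ → ℕ) → ∑< (m + l) f ≡ ∑< m f + ∑< l (λ k → f (m + k))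
∑<-split zero l f = refl
∑<-split (suc m) l f = trans (cong (_+_ (f 0)) (∑<-split m l (f ∘ suc))) (sym (+-assoc (f 0) _ _))

count-tabulate : ∀ {n} {P : A → Set b} (P? : Decidable P) (f : Fin n → A) →
  length (filter P? (tabulate f)) ≡ sum (λ k → ⟦ P? (f k) ⟧)
count-tabulate {n = zero} P? f = refl
count-tabulate {n = suc n} P? f with P? (f fzero)
... | yes _ = cong suc (count-tabulate P? (f ∘ fsuc))
... | no _ = count-tabulate P? (f ∘ fsuc)

count-map-applyUpTo : ∀ {P : A → Set b} (P? : Decidable P) (g : ℕ → A) (f : ℕ → ℕ) m →
  length (filter P? (map g (applyUpTo f m))) ≡ ∑< m (λ k → ⟦ P? (g (f k)) ⟧)
count-map-applyUpTo P? g f zero = refl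
count-map-applyUpTo P? g f (suc m) with P? (g (f 0))
... | yes _ = cong suc (count-map-applyUpTo P? g (f ∘ suc) m)
... | no _ = count-map-applyUpTo P? g (f ∘ suc) m

valleyAt? : (b t a : ℕ) → Dec (t < b × t < a)
valleyAt? b t a = (t <? b) ×-dec (t <? a)

peakAt? : (b t a : ℕ) → Dec (b < t × a < t)
peakAt? b t a = (b <? t) ×-dec (a <? t)

valley+descentFrom≡peak+descentTo : ∀ v b t a → b ≢ t → a ≢ t →
  ⟦ (t <? v) ×-dec valleyAt? b t a ⟧ + ⟦ (t <? v) ×-dec (a <? t) ⟧ ≡
  ⟦ (t <? v) ×-dec peakAt? b t a ⟧ + ⟦ (t <? v) ×-dec (t <? b) ⟧
valley+descentFrom≡peak+descentTo v b t a b≢t a≢t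
  with t <? v | t <? b | b <? t | t <? a | a <? t
... | no _ | _ | _ | _ | _ = refl
... | yes _ | yes t<b | yes b<t | _ | _ = contradiction b<t (<-asym t<b)
... | yes _ | no t≮b | no b≮t | _ | _ = contradiction (≤∧≮⇒≡ (≮⇒≥ t≮b) b≮t) b≢t
... | yes _ | _ | _ | yes t<a | yes a<t = contradiction a<t (<-asym t<a)
... | yes _ | _ | _ | no t≮a | no a≮t = contradiction (≤∧≮⇒≡ (≮⇒≥ t≮a) a≮t) a≢t
... | yes _ | yes _ | no _ | yes _ | no _ = refl
... | yes _ | yes _ | no _ | no _ | yes _ = refl
... | yes _ | no _ | yes _ | yes _ | no _ = refl
... | yes _ | no _ | yes _ | no _ | yes _ = refl

below-split-at-descent : ∀ v {a b} → b < a →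
  ⟦ b <? v ⟧ ≡ ⟦ a <? v ⟧ + ⟦ (v <? a) ×-dec (b <? v) ⟧ + ⟦ (a ≟ v) ×-dec (b <? v) ⟧
below-split-at-descent v {a} {b} b<a with <-cmp a v
... | tri< a<v a≢v _
  rewrite ⟦⟧-yes (b <? v) (<-trans b<a a<v) | ⟦⟧-yes (a <? v) a<v
        | ⟦⟧-no ((v <? a) ×-dec (b <? v)) (<-asym a<v ∘ proj₁)
        | ⟦⟧-no ((a ≟ v) ×-dec (b <? v)) (a≢v ∘ proj₁) = refl
... | tri≈ _ refl _
  rewrite ⟦⟧-yes (b <? a) b<a | ⟦⟧-no (a <? a) (<-irrefl refl)
        | ⟦⟧-no ((a <? a) ×-dec (b <? a)) (<-irrefl refl ∘ proj₁)
        | ⟦⟧-yes ((a ≟ a) ×-dec (b <? a)) (refl , b<a) = refl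
... | tri> _ a≢v v<a
  rewrite ⟦⟧-no (a <? v) (<-asym v<a)
        | ⟦⟧-no ((a ≟ v) ×-dec (b <? v)) (a≢v ∘ proj₁)
        | +-identityʳ ⟦ (v <? a) ×-dec (b <? v) ⟧ = ⟦⟧-cong (v<a ,_) proj₂ (b <? v) _

descentTo≡descentFrom+crossing+leaving : ∀ v a b → a ≢ b →
  ⟦ (b <? v) ×-dec (b <? a) ⟧ ≡
  ⟦ (a <? v) ×-dec (b <? a) ⟧ + ⟦ (v <? a) ×-dec (b <? v) ⟧ + ⟦ (a ≟ v) ×-dec (b <? v) ⟧
descentTo≡descentFrom+crossing+leaving v a b a≢b with <-cmp b a
... | tri< b<a _ _
  rewrite ⟦⟧-×-yesʳ (b <? v) (b <? a) b<a | ⟦⟧-×-yesʳ (a <? v) (b <? a) b<a =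
  below-split-at-descent v b<a
... | tri≈ _ refl _ = contradiction refl a≢b
... | tri> _ _ a<b
  rewrite ⟦⟧-no ((b <? v) ×-dec (b <? a)) (<-asym a<b ∘ proj₂)
        | ⟦⟧-no ((a <? v) ×-dec (b <? a)) (<-asym a<b ∘ proj₂)
        | ⟦⟧-no ((v <? a) ×-dec (b <? v)) (λ (v<a , b<v) → <-asym a<b (<-trans b<v v<a))
        | ⟦⟧-no ((a ≟ v) ×-dec (b <? v)) (λ (a≡v , b<v) → <-asym a<b (subst (b <_) (sym a≡v) b<v)) = refl

-- Indices q refer to the letter at position q + 1 for valleys and peaks, and to the
-- edge from position q to q + 1 otherwise.
module Word (w : ℕ → ℕ) (v : ℕ) where

  valleyBelow peakBelow descentFromBelow descentToBelow crossing leaving : ℕ → ℕ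
  valleyBelow q = ⟦ (w (suc q) <? v) ×-dec valleyAt? (w q) (w (suc q)) (w (suc (suc q))) ⟧
  peakBelow q = ⟦ (w (suc q) <? v) ×-dec peakAt? (w q) (w (suc q)) (w (suc (suc q))) ⟧
  descentFromBelow q = ⟦ (w q <? v) ×-dec (w (suc q) <? w q) ⟧
  descentToBelow q = ⟦ (w (suc q) <? v) ×-dec (w (suc q) <? w q) ⟧
  crossing q = ⟦ (v <? w q) ×-dec (w (suc q) <? v) ⟧
  leaving q = ⟦ (w q ≟ v) ×-dec (w (suc q) <? v) ⟧

  module _ (m : ℕ) (adjacent-≢ : ∀ q → q ≤ m → w q ≢ w (suc q)) where

    valleys+descentsFrom≡peaks+descentsTo :
      ∑< m valleyBelow + ∑< m (descentFromBelow ∘ suc) ≡ ∑< m peakBelow + ∑< m descentToBelow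
    valleys+descentsFrom≡peaks+descentsTo = begin
      ∑< m valleyBelow + ∑< m (descentFromBelow ∘ suc)
        ≡⟨ ∑<-+ m valleyBelow (descentFromBelow ∘ suc) ⟨
      ∑< m (λ q → valleyBelow q + descentFromBelow (suc q))
        ≡⟨ ∑<-cong m balance ⟩
      ∑< m (λ q → peakBelow q + descentToBelow q)
        ≡⟨ ∑<-+ m peakBelow descentToBelow ⟩
      ∑< m peakBelow + ∑< m descentToBelow ∎
      where
      balance : ∀ q → q < m → valleyBelow q + descentFromBelow (suc q) ≡ peakBelow q + descentToBelow q
      balance q q<m = valley+descentFrom≡peak+descentTo v (w q) (w (suc q)) (w (suc (suc q)))
        (adjacent-≢ q (<⇒≤ q<m)) (adjacent-≢ (suc q) q<m ∘ sym)

    descentsTo≡descentsFrom+crossings+leavings : ∑< (suc m) descentToBelow ≡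
      ∑< (suc m) descentFromBelow + ∑< (suc m) crossing + ∑< (suc m) leaving
    descentsTo≡descentsFrom+crossings+leavings = begin
      ∑< (suc m) descentToBelow
        ≡⟨ ∑<-cong (suc m) split ⟩
      ∑< (suc m) (λ q → descentFromBelow q + crossing q + leaving q)
        ≡⟨ ∑<-+ (suc m) (λ q → descentFromBelow q + crossing q) leaving ⟩
      ∑< (suc m) (λ q → descentFromBelow q + crossing q) + ∑< (suc m) leaving
        ≡⟨ cong (_+ ∑< (suc m) leaving) (∑<-+ (suc m) descentFromBelow crossing) ⟩
      ∑< (suc m) descentFromBelow + ∑< (suc m) crossing + ∑< (suc m) leaving ∎
      where
      split : ∀ q → q < suc m → descentToBelow q ≡ descentFromBelow q + crossing q + leaving q
      split q q<1+m = descentTo≡descentFrom+crossing+leaving v (w q) (w (suc q)) (adjacent-≢ q (s≤s⁻¹ q<1+m))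

    valleys≡peaks+crossings+leavings : w 0 < w 1 → ¬ w (suc m) < v →
      ∑< m valleyBelow ≡ ∑< m peakBelow + (∑< (suc m) crossing + ∑< (suc m) leaving)
    valleys≡peaks+crossings+leavings w₀<w₁ w₁₊ₘ≮v = +-cancelʳ-≡ D₊ _ _ (begin
      V + D₊                              ≡⟨ valleys+descentsFrom≡peaks+descentsTo ⟩
      P + ∑< m descentToBelow             ≡⟨ cong (_+_ P) last-descentToBelow ⟨
      P + ∑< (suc m) descentToBelow       ≡⟨ cong (_+_ P) descentsTo≡descentsFrom+crossings+leavings ⟩
      P + (∑< (suc m) descentFromBelow + C + L)
                                          ≡⟨ cong (λ x → P + (x + C + L)) first-descentFromBelow ⟩
      P + (D₊ + C + L)                    ≡⟨ cong (_+_ P) (trans (+-assoc D₊ C L) (+-comm D₊ (C + L))) ⟩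
      P + ((C + L) + D₊)                  ≡⟨ +-assoc P (C + L) D₊ ⟨
      P + (C + L) + D₊                    ∎)
      where
      V P C L D₊ : ℕ
      V = ∑< m valleyBelow
      P = ∑< m peakBelow
      C = ∑< (suc m) crossing
      L = ∑< (suc m) leaving
      D₊ = ∑< m (descentFromBelow ∘ suc)
      first-descentFromBelow : ∑< (suc m) descentFromBelow ≡ D₊
      first-descentFromBelow = cong (_+ D₊) (⟦⟧-no ((w 0 <? v) ×-dec (w 1 <? w 0)) (<-asym w₀<w₁ ∘ proj₂))
      last-descentToBelow : ∑< (suc m) descentToBelow ≡ ∑< m descentToBelow
      last-descentToBelow = trans (∑<-suc m descentToBelow)
        (trans (cong (_+_ (∑< m descentToBelow)) (⟦⟧-no ((w (suc m) <? v) ×-dec _) (w₁₊ₘ≮v ∘ proj₁)))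
               (+-identityʳ _))

+[m+n]-+m≡+n : ∀ m n → + (m + n) - + m ≡ + n
+[m+n]-+m≡+n m n = begin
  + (m + n) - + m   ≡⟨ ℤ.[+m]-[+n]≡m⊖n (m + n) m ⟩
  (m + n) ⊖ m       ≡⟨ ℤ.⊖-≥ (m≤m+n m n) ⟩
  + (m + n ∸ m)     ≡⟨ cong +_ (m+n∸m≡n m n) ⟩
  + n               ∎

module ExtendedWord {n} (σ : Permutation′ n) where

  w : ℕ → ℕ
  w = ext σ

  data Slot : ℕ → Set where
    start : Slot 0
    inner : (p : Fin n) → Slot (suc (toℕ p))
    end : Slot (suc n)

  slot : ∀ {k} → k ≤ suc n → Slot k
  slot {zero} _ = start
  slot {suc k} k≤n with k <? n
  ... | yes k<n = subst (Slot ∘ suc) (toℕ-fromℕ< k<n) (inner (fromℕ< k<n))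
  ... | no k≮n = subst (Slot ∘ suc) (sym (≤∧≮⇒≡ (s≤s⁻¹ k≤n) k≮n)) end

  ext-inner : (p : Fin n) → w (suc (toℕ p)) ≡ val (σ ⟨$⟩ʳ p)
  ext-inner p with toℕ p <? n
  ... | yes p<n = cong (val ∘ (σ ⟨$⟩ʳ_)) (fromℕ<-toℕ p p<n)
  ... | no p≮n = contradiction (toℕ<n p) p≮n

  ext-end : w (suc n) ≡ suc n
  ext-end with n <? n
  ... | yes n<n = contradiction n<n (<-irrefl refl)
  ... | no _ = refl

  inner≢end : (p : Fin n) → w (suc (toℕ p)) ≢ w (suc n)
  inner≢end p e = <-irrefl (suc-injective (trans (sym (ext-inner p)) (trans e ext-end))) (toℕ<n (σ ⟨$⟩ʳ p))

  ext-injective : ∀ {k l} → Slot k → Slot l → w k ≡ w l → k ≡ l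
  ext-injective start start _ = refl
  ext-injective start (inner q) e = contradiction (trans e (ext-inner q)) 0≢1+n
  ext-injective start end e = contradiction (trans e ext-end) 0≢1+n
  ext-injective (inner p) start e = contradiction (trans (sym (ext-inner p)) e) 1+n≢0
  ext-injective (inner p) (inner q) e = cong (suc ∘ toℕ) (begin
    p                          ≡⟨ inverseˡ σ ⟨
    σ ⟨$⟩ˡ (σ ⟨$⟩ʳ p)          ≡⟨ cong (σ ⟨$⟩ˡ_) σp≡σq ⟩
    σ ⟨$⟩ˡ (σ ⟨$⟩ʳ q)          ≡⟨ inverseˡ σ ⟩
    q                          ∎)
    where
    σp≡σq : σ ⟨$⟩ʳ p ≡ σ ⟨$⟩ʳ q
    σp≡σq = toℕ-injective (suc-injective (trans (sym (ext-inner p)) (trans e (ext-inner q))))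
  ext-injective (inner p) end e = contradiction e (inner≢end p)
  ext-injective end start e = contradiction (trans (sym ext-end) e) 1+n≢0
  ext-injective end (inner q) e = contradiction (sym e) (inner≢end q)
  ext-injective end end _ = refl

  adjacent-≢ : ∀ q → q ≤ n → w q ≢ w (suc q)
  adjacent-≢ q q≤n e = 1+n≢n (sym (ext-injective (slot (m≤n⇒m≤1+n q≤n)) (slot (s≤s q≤n)) e))

  starts-with-ascent : w 0 < w 1
  starts-with-ascent = n≢0⇒n>0 λ w₁≡0 → 0≢1+n (ext-injective start (slot (s≤s z≤n)) (sym w₁≡0))

  at-position : (F : ℕ → ℕ → ℕ → A) (p : Fin n) →
    F (before σ (σ ⟨$⟩ʳ p)) (val (σ ⟨$⟩ʳ p)) (after σ (σ ⟨$⟩ʳ p)) ≡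
    F (w (toℕ p)) (w (suc (toℕ p))) (w (suc (suc (toℕ p))))
  at-position F p = begin
    F (w (toℕ p′)) (val (σ ⟨$⟩ʳ p)) (w (suc (suc (toℕ p′))))
      ≡⟨ cong (λ x → F (w (toℕ x)) (val (σ ⟨$⟩ʳ p)) (w (suc (suc (toℕ x))))) (inverseˡ σ) ⟩
    F (w (toℕ p)) (val (σ ⟨$⟩ʳ p)) (w (suc (suc (toℕ p))))
      ≡⟨ cong (λ t → F (w (toℕ p)) t (w (suc (suc (toℕ p))))) (ext-inner p) ⟨
    F (w (toℕ p)) (w (suc (toℕ p))) (w (suc (suc (toℕ p)))) ∎
    where
    p′ : Fin n
    p′ = σ ⟨$⟩ˡ (σ ⟨$⟩ʳ p)

  count-below-by-position : ∀ {R : ℕ → ℕ → ℕ → Set} (R? : ∀ b t a → Dec (R b t a)) (i : Fin n) →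
    length (filter (λ t → (toℕ t <? toℕ i) ×-dec R? (before σ t) (val t) (after σ t)) (allFin n)) ≡
    ∑< n (λ k → ⟦ (w (suc k) <? val i) ×-dec R? (w k) (w (suc k)) (w (suc (suc k))) ⟧)
  count-below-by-position {R} R? i = begin
    length (filter below? (allFin n))        ≡⟨ count-tabulate below? id ⟩
    sum (λ t → ⟦ below? t ⟧)                 ≡⟨ sum-permute (λ t → ⟦ below? t ⟧) σ ⟩
    sum (λ p → ⟦ below? (σ ⟨$⟩ʳ p) ⟧)        ≡⟨ sum-cong-≗ at-position-below ⟩
    ∑< n (λ k → ⟦ (w (suc k) <? val i) ×-dec R? (w k) (w (suc k)) (w (suc (suc k))) ⟧) ∎
    where
    below? : (t : Fin n) → Dec (toℕ t < toℕ i × R (before σ t) (val t) (after σ t))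
    below? t = (toℕ t <? toℕ i) ×-dec R? (before σ t) (val t) (after σ t)
    at-position-below : ∀ p → ⟦ below? (σ ⟨$⟩ʳ p) ⟧ ≡
      ⟦ (w (suc (toℕ p)) <? val i) ×-dec R? (w (toℕ p)) (w (suc (toℕ p))) (w (suc (suc (toℕ p)))) ⟧
    at-position-below p = trans (⟦⟧-cong (map₁ s<s) (map₁ s<s⁻¹) _ _)
      (at-position (λ b t a → ⟦ (t <? val i) ×-dec R? b t a ⟧) p)

module _ {n} (σ : Permutation′ n) (i : Fin n) where
  open ExtendedWord σ
  open Word w (val i)

  private
    j : ℕ
    j = toℕ (σ ⟨$⟩ˡ i)

    j<n : j < n
    j<n = toℕ<n (σ ⟨$⟩ˡ i)

    ext-pos : w (suc j) ≡ val i
    ext-pos = trans (ext-inner (σ ⟨$⟩ˡ i)) (cong val (inverseʳ σ))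

  ends-above : ¬ w (suc n) < val i
  ends-above w₁₊ₙ<i = <-asym (toℕ<n i) (s<s⁻¹ (subst (_< val i) ext-end w₁₊ₙ<i))

  -- crossing q is ⟦ straddle? σ i (suc q) ⟧ by definition.
  crossings≡pat31-2+pat2-31 : ∑< (suc n) crossing ≡ pat31-2 σ i + pat2-31 σ i
  crossings≡pat31-2+pat2-31 = begin
    ∑< (suc n) crossing
      ≡⟨ cong (λ m → ∑< m crossing) (cong suc (m+[n∸m]≡n (<⇒≤ j<n))) ⟨
    ∑< (suc j + (n ∸ j)) crossing
      ≡⟨ ∑<-split (suc j) (n ∸ j) crossing ⟩
    ∑< (suc j) crossing + ∑< (n ∸ j) (λ k → crossing (suc j + k))
      ≡⟨ cong (_+ ∑< (n ∸ j) (λ k → crossing (suc j + k))) no-crossing-at-i ⟩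
    ∑< j crossing + ∑< (n ∸ j) (λ k → crossing (suc j + k))
      ≡⟨ cong₂ _+_ (count-map-applyUpTo (straddle? σ i) suc id j)
                   (count-map-applyUpTo (straddle? σ i) (λ m → suc (pos σ i + m)) id (n ∸ j)) ⟨
    pat31-2 σ i + pat2-31 σ i ∎
    where
    no-crossing-at-i : ∑< (suc j) crossing ≡ ∑< j crossing
    no-crossing-at-i = trans (∑<-suc j crossing) (trans
      (cong (λ x → ∑< j crossing + x) (⟦⟧-no ((val i <? w j) ×-dec (w (suc j) <? val i)) λ (_ , lt) → <-irrefl ext-pos lt))
      (+-identityʳ _))

  leavings≡descent : ∑< (suc n) leaving ≡ ⟦ after σ i <? val i ⟧
  leavings≡descent = trans (∑<-single (suc n) leaving (s≤s j<n) not-at-i)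
    (⟦⟧-cong proj₂ (ext-pos ,_) _ (after σ i <? val i))
    where
    not-at-i : ∀ k → k < suc n → k ≢ suc j → leaving k ≡ 0
    not-at-i k k<1+n k≢1+j = ⟦⟧-no _ λ (wₖ≡i , _) →
      k≢1+j (ext-injective (slot (m≤n⇒m≤1+n (s≤s⁻¹ k<1+n))) (slot (s≤s (<⇒≤ j<n))) (trans wₖ≡i (sym ext-pos)))

  h≡pat31-2+pat2-31+descent : h σ i ≡ + (pat31-2 σ i + pat2-31 σ i + ⟦ after σ i <? val i ⟧)
  h≡pat31-2+pat2-31+descent = begin
    h σ i
      ≡⟨ cong₂ (λ x y → + x - + y) (count-below-by-position valleyAt? i) (count-below-by-position peakAt? i) ⟩
    + ∑< n valleyBelow - + ∑< n peakBelow
      ≡⟨ cong (λ x → + x - + ∑< n peakBelow)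
           (valleys≡peaks+crossings+leavings n adjacent-≢ starts-with-ascent ends-above) ⟩
    + (∑< n peakBelow + (∑< (suc n) crossing + ∑< (suc n) leaving)) - + ∑< n peakBelow
      ≡⟨ +[m+n]-+m≡+n (∑< n peakBelow) _ ⟩
    + (∑< (suc n) crossing + ∑< (suc n) leaving)
      ≡⟨ cong +_ (cong₂ _+_ crossings≡pat31-2+pat2-31 leavings≡descent) ⟩
    + (pat31-2 σ i + pat2-31 σ i + ⟦ after σ i <? val i ⟧) ∎

lemma2 : (n : ℕ) (σ : Permutation′ n) (i : Fin n) →
    (AscentStart σ i → + (pat31-2 σ i + pat2-31 σ i) ≡ h σ i)
    × (DescentStart σ i → + (pat31-2 σ i + pat2-31 σ i) ≡ h σ i - + 1)
lemma2 n σ i = ascent , descent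
  where
  S : ℕ
  S = pat31-2 σ i + pat2-31 σ i

  ascent : AscentStart σ i → + S ≡ h σ i
  ascent i<after = sym (begin
    h σ i                               ≡⟨ h≡pat31-2+pat2-31+descent σ i ⟩
    + (S + ⟦ after σ i <? val i ⟧)      ≡⟨ cong (λ x → + (S + x)) (⟦⟧-no (after σ i <? val i) (<-asym i<after)) ⟩
    + (S + 0)                           ≡⟨ cong +_ (+-identityʳ S) ⟩
    + S                                 ∎)

  descent : DescentStart σ i → + S ≡ h σ i - + 1
  descent after<i = sym (begin
    h σ i - + 1                          ≡⟨ cong (_- + 1) (h≡pat31-2+pat2-31+descent σ i) ⟩
    + (S + ⟦ after σ i <? val i ⟧) - + 1 ≡⟨ cong (λ x → + (S + x) - + 1) (⟦⟧-yes (after σ i <? val i) after<i) ⟩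
    + (S + 1) - + 1                      ≡⟨ cong (λ x → + x - + 1) (+-comm S 1) ⟩
    + (1 + S) - + 1                      ≡⟨ +[m+n]-+m≡+n 1 S ⟩
    + S                                  ∎)
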